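{- For every positive integer $n$, the number of nonterminal ascending compositions of $n$ equals $p(n-2)$.
   Context: $p(n)$ denotes the number of partitions of $n$, with the conventions $p(0)=1$ and $p(j)=0$ for $j<0$. An ascending composition of a positive integer $n$ is a sequence of positive integers $\langle a_1,\dots,a_k\rangle$ with $a_1+\dots+a_k=n$ and $a_1\le\dots\le a_k$. An ascending composition $\langle a_1,\dots,a_k\rangle$ is called nonterminal if $k>1$ and $2a_{k-1}>a_k$. Equivalently, the claim says that the number of partitions of $n$ whose largest part $y$ and second largest part $x$ satisfy $2x>y$ equals $p(n-2)$. -}

module Defs where

open import Data.Nat using (ℕ; zero; suc; _+_; _≤_; _<_; _*_; _≤?_; _<?_)
open import Data.Nat.Properties using (_≟_)
open import Data.Nat.ListAction using (sum)
open import Data.List using (List; []; _∷_; length; map; concatMap; filter; upTo)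
open import Data.Product using (_×_)
open import Data.Unit using (⊤)
open import Data.Empty using (⊥)
open import Relation.Binary.PropositionalEquality using (_≡_)
open import Relation.Nullary using (Dec; yes; no; ¬_)
open import Relation.Nullary.Decidable using (_×-dec_)

listsOfLen : ℕ → ℕ → List (List ℕ)
listsOfLen n zero = [] ∷ []
listsOfLen n (suc k) =
  concatMap (λ a → map (a ∷_) (listsOfLen n k)) (map suc (upTo n))

-- All lists of length in {1,…,n} with entries in {1,…,n}
-- (every composition of a positive integer n is among these).
candidates : ℕ → List (List ℕ)
candidates n = concatMap (listsOfLen n) (map suc (upTo n))

Ascending : List ℕ → Set
Ascending [] = ⊤
Ascending (a ∷ []) = ⊤
Ascending (a ∷ b ∷ xs) = a ≤ b × Ascending (b ∷ xs)

ascending? : (xs : List ℕ) → Dec (Ascending xs)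
ascending? [] = yes _
ascending? (a ∷ []) = yes _
ascending? (a ∷ b ∷ xs) = (a ≤? b) ×-dec ascending? (b ∷ xs)

Positive : List ℕ → Set
Positive [] = ⊤
Positive (a ∷ xs) = 0 < a × Positive xs

positive? : (xs : List ℕ) → Dec (Positive xs)
positive? [] = yes _
positive? (a ∷ xs) = (0 <? a) ×-dec positive? xs

IsAscComp : ℕ → List ℕ → Set
IsAscComp n xs = Positive xs × Ascending xs × sum xs ≡ n

isAscComp? : (n : ℕ) → (xs : List ℕ) → Dec (IsAscComp n xs)
isAscComp? n xs = positive? xs ×-dec (ascending? xs ×-dec (sum xs ≟ n))

Nonterminal : List ℕ → Set
Nonterminal [] = ⊥
Nonterminal (a ∷ []) = ⊥
Nonterminal (a ∷ b ∷ []) = b < 2 * a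
Nonterminal (a ∷ b ∷ c ∷ xs) = Nonterminal (b ∷ c ∷ xs)

nonterminal? : (xs : List ℕ) → Dec (Nonterminal xs)
nonterminal? [] = no (λ ())
nonterminal? (a ∷ []) = no (λ ())
nonterminal? (a ∷ b ∷ []) = b <? 2 * a
nonterminal? (a ∷ b ∷ c ∷ xs) = nonterminal? (b ∷ c ∷ xs)

ascComps : ℕ → List (List ℕ)
ascComps n = filter (isAscComp? n) (candidates n)

numNonterminal : ℕ → ℕ
numNonterminal n =
  length (filter (λ xs → isAscComp? n xs ×-dec nonterminal? xs) (candidates n))

-- Partition function: p(0) = 1 (the empty partition), p(n) = number of
-- ascending compositions (= partitions written in weakly increasing order)
-- for n ≥ 1.
p : ℕ → ℕ
p zero = 1
p (suc n) = length (ascComps (suc n))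

-- p(n - 2) with the convention p(j) = 0 for j < 0.
pMinus2 : ℕ → ℕ
pMinus2 zero = 0
pMinus2 (suc zero) = 0
pMinus2 (suc (suc m)) = p m

module Submission where

-- Write P(n,m) for the number of partitions of n into parts ≥ m (as
-- ascending lists) and N(n,m) for the number of nonterminal ones.  Sorting
-- partitions by whether their smallest part equals m gives, for 1 ≤ m ≤ n,
--   P(n,m) = P(n-m,m) + P(n,m+1),
--   N(n,m) = T(n-m,m) + N(n-m,m) + N(n,m+1),
-- where T(k,m) counts the one-part tails ⟨k⟩ with k < 2m, i.e. those for
-- which ⟨m,k⟩ is itself nonterminal.  Since a partition of k < 2m into parts
-- ≥ m has at most one part, these counts are 0 or 1 in that range.  An
-- induction on j - 2m then shows N(2+j,m) = P(j,m) whenever 2m ≤ 2+j, and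
-- the corollary is the case m = 1.

open import Defs
open import Data.Nat using (ℕ; zero; suc; _+_; _*_; _∸_; _≤_; _<_; z≤n; s≤s; _≤?_; _<?_)
open import Data.Nat.Properties
open import Data.Nat.ListAction using (sum)
open import Data.List using (List; []; _∷_; length; map; concatMap; filter; upTo; _++_)
open import Data.List.Properties using (length-++; filter-++; filter-none; filter-accept; ∷-injectiveʳ)
open import Data.List.Membership.Propositional using (_∈_; find; lose)
open import Data.List.Membership.Propositional.Properties
  using (∈-++⁻; ∈-++⁺ˡ; ∈-++⁺ʳ; ∈-map⁺; ∈-map⁻; ∈-filter⁺; ∈-filter⁻; ∈-upTo⁺; ∈-concatMap⁺; ∈-concatMap⁻)
open import Data.List.Membership.Propositional.Properties.WithK using (unique∧set⇒bag)
open import Data.List.Relation.Binary.BagAndSetEquality using (∼bag⇒↭)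
open import Data.List.Relation.Binary.Permutation.Propositional.Properties using (↭-length)
open import Data.List.Relation.Unary.Unique.Propositional using (Unique)
open import Data.List.Relation.Unary.AllPairs using ([]; _∷_)
import Data.List.Relation.Unary.Unique.Propositional.Properties as Unique
open import Data.List.Relation.Unary.All as All using (All; []; _∷_)
open import Data.List.Relation.Unary.Any using (here)
open import Data.Product using (_×_; _,_; proj₁; proj₂)
open import Data.Sum using (inj₁; inj₂)
open import Data.Empty using (⊥; ⊥-elim)
open import Data.Unit using (tt)
open import Data.Bool using (true; false)
open import Function using (id)
open import Function.Bundles using (_⇔_; mk⇔; Equivalence)
open import Relation.Nullary using (yes; no; ¬_; does)
open import Relation.Nullary.Decidable using (_×-dec_)
open import Relation.Unary using (Decidable)
open import Relation.Unary.Properties using (U?)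
open import Relation.Binary.PropositionalEquality using (_≡_; refl; sym; trans; cong; cong₂; subst; module ≡-Reasoning)

open ≡-Reasoning

length-≡ : {A : Set} {xs ys : List A} → Unique xs → Unique ys →
           (∀ {x} → x ∈ xs ⇔ x ∈ ys) → length xs ≡ length ys
length-≡ u v same = ↭-length (∼bag⇒↭ (unique∧set⇒bag u v same))

filter-length-≡ : {A : Set} {Q : A → Set} (Q? : Decidable Q) {xs ys : List A} →
                  Unique xs → Unique ys → (∀ {x} → x ∈ xs → x ∈ ys) → (∀ {x} → x ∈ ys → x ∈ xs) →
                  length (filter Q? xs) ≡ length (filter Q? ys)
filter-length-≡ Q? u v xs⊆ys ys⊆xs =
  length-≡ (Unique.filter⁺ Q? u) (Unique.filter⁺ Q? v) (mk⇔ (transfer xs⊆ys) (transfer ys⊆xs))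
  where
  transfer : ∀ {xs ys} → (∀ {x} → x ∈ xs → x ∈ ys) → ∀ {x} → x ∈ filter Q? xs → x ∈ filter Q? ys
  transfer sub x∈ with ∈-filter⁻ Q? x∈
  ... | x∈xs , qx = ∈-filter⁺ Q? (sub x∈xs) qx

length-filter-map : {A B : Set} {Q : B → Set} (Q? : Decidable Q) (g : A → B) (xs : List A) →
                    length (filter Q? (map g xs)) ≡ length (filter (λ x → Q? (g x)) xs)
length-filter-map Q? g [] = refl
length-filter-map Q? g (x ∷ xs) with does (Q? (g x))
... | true = cong suc (length-filter-map Q? g xs)
... | false = length-filter-map Q? g xs

length-filter-none : {A : Set} {Q : A → Set} (Q? : Decidable Q) (xs : List A) →
                     (∀ {x} → x ∈ xs → ¬ Q x) → length (filter Q? xs) ≡ 0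
length-filter-none Q? xs none = cong length (filter-none Q? (All.tabulate none))

concatMap-unique : {B : Set} (f : ℕ → List B) (key : B → ℕ) →
                   (∀ k {x} → x ∈ f k → key x ≡ k) → (∀ k → Unique (f k)) →
                   {ks : List ℕ} → Unique ks → Unique (concatMap f ks)
concatMap-unique f key keyed uf {[]} [] = []
concatMap-unique f key keyed uf {k ∷ ks} (k∉ks ∷ u) =
  Unique.++⁺ (uf k) (concatMap-unique f key keyed uf u) disjoint
  where
  disjoint : ∀ {x} → ¬ (x ∈ f k × x ∈ concatMap f ks)
  disjoint (x∈fk , x∈rest) with find (∈-concatMap⁻ f x∈rest)
  ... | k′ , k′∈ks , x∈fk′ = All.lookup k∉ks k′∈ks (trans (sym (keyed k x∈fk)) (keyed k′ x∈fk′))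

ascending-cons : ∀ {a} y → All (a ≤_) y → Ascending y → Ascending (a ∷ y)
ascending-cons [] _ _ = tt
ascending-cons (b ∷ y) (a≤b ∷ _) asc = a≤b , asc

ascending-head≤ : ∀ {a} y → Ascending (a ∷ y) → All (a ≤_) y
ascending-head≤ [] _ = []
ascending-head≤ (b ∷ y) (a≤b , asc) = a≤b ∷ All.map (≤-trans a≤b) (ascending-head≤ y asc)

ascending-tail : ∀ {a} y → Ascending (a ∷ y) → Ascending y
ascending-tail [] _ = tt
ascending-tail (b ∷ y) (_ , asc) = asc

Partition : ℕ → ℕ → List ℕ → Set
Partition m n x = Ascending x × All (m ≤_) x × sum x ≡ n

-- Partitions of n into parts ≥ m: those with smallest part m, then those
-- with all parts ≥ m+1.  The fuel f suffices when n < f + m (and m ≥ 1).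
enum : ℕ → ℕ → ℕ → List (List ℕ)
enum f zero m = [] ∷ []
enum zero (suc n) m = []
enum (suc f) (suc n) m with m ≤? suc n
... | yes _ = map (m ∷_) (enum f (suc n ∸ m) m) ++ enum f (suc n) (suc m)
... | no _ = []

enum-sound : ∀ f n m {x} → x ∈ enum f n m → Partition m n x
enum-sound f zero m (here refl) = tt , [] , refl
enum-sound (suc f) (suc n) m x∈ with m ≤? suc n
enum-sound (suc f) (suc n) m x∈ | yes m≤n with ∈-++⁻ (map (m ∷_) (enum f (suc n ∸ m) m)) x∈
... | inj₁ x∈first with ∈-map⁻ (m ∷_) x∈first
...   | y , y∈ , refl with enum-sound f (suc n ∸ m) m y∈
...     | asc , parts , s = ascending-cons y parts asc , ≤-refl ∷ parts , trans (cong (m +_) s) (m+[n∸m]≡n m≤n)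
enum-sound (suc f) (suc n) m x∈ | yes m≤n | inj₂ x∈rest with enum-sound f (suc n) (suc m) x∈rest
... | asc , parts , s = asc , All.map (≤-trans (n≤1+n m)) parts , s

enum-complete : ∀ f n m {x} → 1 ≤ m → n < f + m → Partition m n x → x ∈ enum f n m
enum-complete f zero m {[]} _ _ _ = here refl
enum-complete f zero m {a ∷ y} 1≤m _ (_ , m≤a ∷ _ , s) =
  ⊥-elim (<⇒≱ (≤-trans 1≤m m≤a) (subst (a ≤_) s (m≤m+n a (sum y))))
enum-complete f (suc n) m {[]} _ _ (_ , _ , ())
enum-complete zero (suc n) m {a ∷ y} _ n<m (_ , m≤a ∷ _ , s) =
  ⊥-elim (<⇒≱ n<m (≤-trans m≤a (subst (a ≤_) s (m≤m+n a (sum y)))))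
enum-complete (suc f) (suc n) m {a ∷ y} 1≤m bound (asc , m≤a ∷ _ , s) with m ≤? suc n
... | no m≰n = ⊥-elim (m≰n (≤-trans m≤a (subst (a ≤_) s (m≤m+n a (sum y)))))
... | yes m≤n with m≤n⇒m<n∨m≡n m≤a
...   | inj₁ m<a = ∈-++⁺ʳ (map (m ∷_) (enum f (suc n ∸ m) m))
          (enum-complete f (suc n) (suc m) (s≤s z≤n) (subst (suc (suc n) ≤_) (sym (+-suc f m)) bound)
            (asc , m<a ∷ All.map (≤-trans m<a) (ascending-head≤ y asc) , s))
...   | inj₂ refl = ∈-++⁺ˡ (∈-map⁺ (m ∷_)
          (enum-complete f (suc n ∸ m) m 1≤m (≤-trans (s≤s (∸-monoʳ-≤ (suc n) 1≤m)) (≤-pred bound))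
            (ascending-tail y asc , ascending-head≤ y asc , trans (sym (m+n∸m≡n m (sum y))) (cong (_∸ m) s))))

-- The two blocks are disjoint: lists in the first start with m, lists in the
-- second have all parts > m.
enum-unique : ∀ f n m → Unique (enum f n m)
enum-unique f zero m = [] ∷ []
enum-unique zero (suc n) m = []
enum-unique (suc f) (suc n) m with m ≤? suc n
... | no _ = []
... | yes _ = Unique.++⁺ (Unique.map⁺ ∷-injectiveʳ (enum-unique f (suc n ∸ m) m))
                         (enum-unique f (suc n) (suc m)) disjoint
  where
  disjoint : ∀ {x} → ¬ (x ∈ map (m ∷_) (enum f (suc n ∸ m) m) × x ∈ enum f (suc n) (suc m))
  disjoint (x∈first , x∈rest) with ∈-map⁻ (m ∷_) x∈first
  ... | _ , _ , refl with enum-sound f (suc n) (suc m) x∈rest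
  ...   | _ , m<m ∷ _ , _ = <-irrefl refl m<m

partitions : ℕ → ℕ → List (List ℕ)
partitions n m = enum (suc n) n m

count : {Q : List ℕ → Set} → Decidable Q → ℕ → ℕ → ℕ
count Q? n m = length (filter Q? (partitions n m))

partitions-complete : ∀ {n m x} → 1 ≤ m → Partition m n x → x ∈ partitions n m
partitions-complete {n} {m} 1≤m = enum-complete (suc n) n m 1≤m (s≤s (m≤m+n n m))

count-fuel : {Q : List ℕ → Set} (Q? : Decidable Q) → ∀ f n m → 1 ≤ m → n < f + m →
             length (filter Q? (enum f n m)) ≡ count Q? n m
count-fuel Q? f n m 1≤m bound =
  filter-length-≡ Q? (enum-unique f n m) (enum-unique (suc n) n m)
    (λ x∈ → partitions-complete 1≤m (enum-sound f n m x∈))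
    (λ x∈ → enum-complete f n m 1≤m bound (enum-sound (suc n) n m x∈))

count-split : {Q : List ℕ → Set} (Q? : Decidable Q) → ∀ {n m} → 1 ≤ m → m ≤ n →
              count Q? n m ≡ count (λ x → Q? (m ∷ x)) (n ∸ m) m + count Q? n (suc m)
count-split Q? {zero} 1≤m m≤0 = ⊥-elim (<⇒≱ 1≤m m≤0)
count-split Q? {suc n} {m} 1≤m m≤n with m ≤? suc n
... | no m≰n = ⊥-elim (m≰n m≤n)
... | yes _ = begin
    length (filter Q? (map (m ∷_) first ++ rest))
      ≡⟨ cong length (filter-++ Q? (map (m ∷_) first) rest) ⟩
    length (filter Q? (map (m ∷_) first) ++ filter Q? rest)
      ≡⟨ length-++ (filter Q? (map (m ∷_) first)) ⟩
    length (filter Q? (map (m ∷_) first)) + length (filter Q? rest)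
      ≡⟨ cong₂ _+_ (trans (length-filter-map Q? (m ∷_) first)
                          (count-fuel (λ x → Q? (m ∷ x)) (suc n) (suc n ∸ m) m 1≤m
                                      (≤-<-trans (m∸n≤m (suc n) m) (m<m+n (suc n) 1≤m))))
                   (count-fuel Q? (suc n) (suc n) (suc m) (s≤s z≤n) (m<m+n (suc n) (s≤s z≤n))) ⟩
    count (λ x → Q? (m ∷ x)) (suc n ∸ m) m + count Q? (suc n) (suc m) ∎
  where
  first = enum (suc n) (suc n ∸ m) m
  rest = enum (suc n) (suc n) (suc m)

two-parts-≥ : ∀ {m a b} z → m ≤ a → m ≤ b → 2 * m ≤ sum (a ∷ b ∷ z)
two-parts-≥ z m≤a m≤b = +-mono-≤ m≤a (+-mono-≤ m≤b z≤n)

one-part : ∀ {m k} x → 1 ≤ k → k < 2 * m → Partition m k x → x ≡ k ∷ []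
one-part [] 1≤k _ (_ , _ , refl) = ⊥-elim (<⇒≱ 1≤k z≤n)
one-part (b ∷ []) _ _ (_ , _ , s) = cong (_∷ []) (trans (sym (+-identityʳ b)) s)
one-part (a ∷ b ∷ z) _ k<2m (_ , m≤a ∷ m≤b ∷ _ , s) =
  ⊥-elim (<⇒≱ k<2m (subst (_ ≤_) s (two-parts-≥ z m≤a m≤b)))

count-one-part : {Q : List ℕ → Set} (Q? : Decidable Q) → ∀ {m k} → 1 ≤ m → m ≤ k → k < 2 * m →
                 count Q? k m ≡ length (filter Q? ((k ∷ []) ∷ []))
count-one-part Q? {m} {k} 1≤m m≤k k<2m =
  filter-length-≡ Q? (enum-unique (suc k) k m) ([] ∷ [])
    (λ {x} x∈ → here (one-part x (≤-trans 1≤m m≤k) k<2m (enum-sound (suc k) k m x∈)))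
    (λ { (here refl) → partitions-complete 1≤m (tt , m≤k ∷ [] , +-identityʳ k) })

-- The tail x makes m ∷ x nonterminal by consisting of one part b < 2m.
PairTail : ℕ → List ℕ → Set
PairTail m (b ∷ []) = b < 2 * m
PairTail m _ = ⊥

pairTail? : ∀ m → Decidable (PairTail m)
pairTail? m (b ∷ []) = b <? 2 * m
pairTail? m [] = no id
pairTail? m (_ ∷ _ ∷ _) = no id

-- P(n,m), N(n,m) and T(n,m) of the overview.
partCount : ℕ → ℕ → ℕ
partCount = count U?

ntCount : ℕ → ℕ → ℕ
ntCount = count nonterminal?

tailCount : ℕ → ℕ → ℕ
tailCount k m = count (pairTail? m) k m

-- m ∷ x is nonterminal iff x is a pair tail or is itself nonterminal, and
-- these cases exclude each other.
nonterminal-cons-count : ∀ m (xs : List (List ℕ)) →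
  length (filter (λ x → nonterminal? (m ∷ x)) xs) ≡ length (filter (pairTail? m) xs) + length (filter nonterminal? xs)
nonterminal-cons-count m [] = refl
nonterminal-cons-count m ([] ∷ xs) = nonterminal-cons-count m xs
nonterminal-cons-count m ((b ∷ []) ∷ xs) with does (b <? 2 * m)
... | true = cong suc (nonterminal-cons-count m xs)
... | false = nonterminal-cons-count m xs
nonterminal-cons-count m ((b ∷ c ∷ z) ∷ xs) with does (nonterminal? (b ∷ c ∷ z))
... | true = trans (cong suc (nonterminal-cons-count m xs)) (sym (+-suc _ _))
... | false = nonterminal-cons-count m xs

partCount-split : ∀ {n m} → 1 ≤ m → m ≤ n → partCount n m ≡ partCount (n ∸ m) m + partCount n (suc m)
partCount-split = count-split U?

ntCount-split : ∀ {n m} → 1 ≤ m → m ≤ n →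
  ntCount n m ≡ (tailCount (n ∸ m) m + ntCount (n ∸ m) m) + ntCount n (suc m)
ntCount-split {n} {m} 1≤m m≤n =
  trans (count-split nonterminal? 1≤m m≤n)
        (cong (_+ ntCount n (suc m)) (nonterminal-cons-count m (partitions (n ∸ m) m)))

-- A nonterminal partition has at least two parts, so it is not of n < 2m.
ntCount-vanish : ∀ {n m} → n < 2 * m → ntCount n m ≡ 0
ntCount-vanish {n} {m} n<2m = length-filter-none nonterminal? (partitions n m) not-nonterminal
  where
  not-nonterminal : ∀ {x} → x ∈ partitions n m → ¬ Nonterminal x
  not-nonterminal {a ∷ b ∷ z} x∈ _ with enum-sound (suc n) n m x∈
  ... | _ , m≤a ∷ m≤b ∷ _ , s = <⇒≱ n<2m (subst (_ ≤_) s (two-parts-≥ z m≤a m≤b))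

-- A pair tail ⟨b⟩ has b < 2m, so it is not a partition of k ≥ 2m.
tailCount-vanish : ∀ {k m} → 2 * m ≤ k → tailCount k m ≡ 0
tailCount-vanish {k} {m} 2m≤k = length-filter-none (pairTail? m) (partitions k m) not-tail
  where
  not-tail : ∀ {x} → x ∈ partitions k m → ¬ PairTail m x
  not-tail {b ∷ []} x∈ b<2m with enum-sound (suc k) k m x∈
  ... | _ , _ , s = <⇒≱ b<2m (subst (2 * m ≤_) (trans (sym s) (+-identityʳ b)) 2m≤k)

partCount-one : ∀ {k m} → 1 ≤ m → m ≤ k → k < 2 * m → partCount k m ≡ 1
partCount-one 1≤m m≤k k<2m = count-one-part U? 1≤m m≤k k<2m

tailCount-one : ∀ {k m} → 1 ≤ m → m ≤ k → k < 2 * m → tailCount k m ≡ 1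
tailCount-one {m = m} 1≤m m≤k k<2m =
  trans (count-one-part (pairTail? m) 1≤m m≤k k<2m) (cong length (filter-accept (pairTail? m) k<2m))

double : ∀ m → 2 * m ≡ m + m
double m = cong (m +_) (+-identityʳ m)

-- Base range 2m ≤ 2+j < 2m+2: both sides equal 1.  For m = 1 this is a
-- direct computation; for m ≥ 2 the only nonterminal partition of 2+j is
-- ⟨m, 2+j-m⟩ and the only partition of j is ⟨j⟩.
ntCount-narrow : ∀ {m j} → 2 * m ≤ 2 + j → j < 2 * m → ntCount (2 + j) m ≡ partCount j m
ntCount-narrow {zero} _ ()
ntCount-narrow {1} {0} _ _ = refl
ntCount-narrow {1} {1} _ _ = refl
ntCount-narrow {1} {suc (suc j)} _ (s≤s (s≤s ()))
ntCount-narrow {m@(suc (suc l))} {j} 2m≤2+j j<2m = begin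
    ntCount (2 + j) m
      ≡⟨ ntCount-split 1≤m (≤-trans m≤j (m≤n+m j 2)) ⟩
    (tailCount (2 + j ∸ m) m + ntCount (2 + j ∸ m) m) + ntCount (2 + j) (suc m)
      ≡⟨ cong₂ _+_ (cong₂ _+_ (tailCount-one {m = m} 1≤m m≤rest rest<2m) (ntCount-vanish {m = m} rest<2m))
                   (ntCount-vanish {m = suc m} 2+j<2[m+1]) ⟩
    1
      ≡⟨ sym (partCount-one 1≤m m≤j j<2m) ⟩
    partCount j m ∎
  where
  1≤m : 1 ≤ m
  1≤m = s≤s z≤n
  m+m≤2+j : m + m ≤ 2 + j
  m+m≤2+j = subst (_≤ 2 + j) (double m) 2m≤2+j
  m≤j : m ≤ j
  m≤j = +-cancelˡ-≤ 2 m j (≤-trans (+-monoˡ-≤ m (s≤s (s≤s z≤n))) m+m≤2+j)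
  m≤rest : m ≤ 2 + j ∸ m
  m≤rest = m+n≤o⇒m≤o∸n m m+m≤2+j
  rest<2m : 2 + j ∸ m < 2 * m
  rest<2m = m<n+o⇒m∸n<o (2 + j) m (≤-trans (s≤s (s≤s j<2m)) (+-monoˡ-≤ (2 * m) (s≤s (s≤s z≤n))))
  2+j<2[m+1] : 2 + j < 2 * suc m
  2+j<2[m+1] = subst (2 + j <_) (sym (*-suc 2 m)) (s≤s (s≤s j<2m))

-- Main identity, by induction on j - 2m (the fuel k bounds it).  For
-- 2m ≤ j, split off the smallest part: the partitions with smallest part
-- > m are handled by induction at m+1, those with smallest part m by
-- `first-part` below, and the partitions of j split in the same way.
ntCount-shift : ∀ k {m j} → 1 ≤ m → 2 * m ≤ 2 + j → j < k + 2 * m → ntCount (2 + j) m ≡ partCount j m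
ntCount-shift k {m} {j} 1≤m 2m≤2+j bound with 2 * m ≤? j
... | no 2m≰j = ntCount-narrow 2m≤2+j (≰⇒> 2m≰j)
ntCount-shift zero 1≤m _ j<2m | yes 2m≤j = ⊥-elim (<⇒≱ j<2m 2m≤j)
ntCount-shift (suc k) {m} {j} 1≤m _ bound | yes 2m≤j = begin
    ntCount (2 + j) m
      ≡⟨ ntCount-split 1≤m (≤-trans m≤j (m≤n+m j 2)) ⟩
    (tailCount (2 + j ∸ m) m + ntCount (2 + j ∸ m) m) + ntCount (2 + j) (suc m)
      ≡⟨ cong (λ r → (tailCount r m + ntCount r m) + ntCount (2 + j) (suc m)) (+-∸-assoc 2 m≤j) ⟩
    (tailCount (2 + i) m + ntCount (2 + i) m) + ntCount (2 + j) (suc m)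
      ≡⟨ cong₂ _+_ first-part (ntCount-shift k (s≤s z≤n) 2[m+1]≤2+j bound-next) ⟩
    partCount i m + partCount j (suc m)
      ≡⟨ sym (partCount-split 1≤m m≤j) ⟩
    partCount j m ∎
  where
  i = j ∸ m
  m≤j : m ≤ j
  m≤j = ≤-trans (m≤m+n m (m + 0)) 2m≤j
  m≤i : m ≤ i
  m≤i = m+n≤o⇒m≤o∸n m (subst (_≤ j) (double m) 2m≤j)
  2[m+1]≤2+j : 2 * suc m ≤ 2 + j
  2[m+1]≤2+j = subst (_≤ 2 + j) (sym (*-suc 2 m)) (+-monoʳ-≤ 2 2m≤j)
  bound-next : j < k + 2 * suc m
  bound-next = ≤-<-trans (≤-pred bound) (+-monoʳ-< k (subst (2 * m <_) (sym (*-suc 2 m)) (s≤s (n≤1+n (2 * m)))))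
  -- Partitions of 2+j with smallest part m correspond to partitions of
  -- 2+i with parts ≥ m, counted by T + N; they match P(i,m).
  first-part : tailCount (2 + i) m + ntCount (2 + i) m ≡ partCount i m
  first-part with 2 * m ≤? 2 + i
  ... | yes 2m≤2+i = cong₂ _+_ (tailCount-vanish {m = m} 2m≤2+i)
                               (ntCount-shift k 1≤m 2m≤2+i (<-≤-trans (∸-monoʳ-< 1≤m m≤j) (≤-pred bound)))
  ... | no 2m≰2+i = trans (cong₂ _+_ (tailCount-one {m = m} 1≤m (≤-trans m≤i (m≤n+m i 2)) 2+i<2m) (ntCount-vanish {m = m} 2+i<2m))
                          (sym (partCount-one 1≤m m≤i (≤-<-trans (m≤n+m i 2) 2+i<2m)))
    where
    2+i<2m : 2 + i < 2 * m
    2+i<2m = ≰⇒> 2m≰2+i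

entries : ℕ → List ℕ
entries n = map suc (upTo n)

entries-unique : ∀ n → Unique (entries n)
entries-unique n = Unique.map⁺ suc-injective (Unique.upTo⁺ n)

entries-complete : ∀ {a n} → 1 ≤ a → a ≤ n → a ∈ entries n
entries-complete {suc a} (s≤s _) a≤n = ∈-map⁺ suc (∈-upTo⁺ a≤n)

listsOfLen-length : ∀ n k {x} → x ∈ listsOfLen n k → length x ≡ k
listsOfLen-length n zero (here refl) = refl
listsOfLen-length n (suc k) x∈ with find (∈-concatMap⁻ (λ a → map (a ∷_) (listsOfLen n k)) {xs = entries n} x∈)
... | _ , _ , x∈block with ∈-map⁻ _ x∈block
...   | y , y∈ , refl = cong suc (listsOfLen-length n k y∈)

-- Lists of a fixed length are grouped by their head.
listsOfLen-unique : ∀ n k → Unique (listsOfLen n k)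
listsOfLen-unique n zero = [] ∷ []
listsOfLen-unique n (suc k) =
  concatMap-unique (λ a → map (a ∷_) (listsOfLen n k)) head headed
    (λ a → Unique.map⁺ ∷-injectiveʳ (listsOfLen-unique n k)) (entries-unique n)
  where
  head : List ℕ → ℕ
  head [] = 0
  head (a ∷ _) = a
  headed : ∀ a {x} → x ∈ map (a ∷_) (listsOfLen n k) → head x ≡ a
  headed a x∈ with ∈-map⁻ _ x∈
  ... | _ , _ , refl = refl

listsOfLen-complete : ∀ n {x} → All (_∈ entries n) x → x ∈ listsOfLen n (length x)
listsOfLen-complete n [] = here refl
listsOfLen-complete n (a∈ ∷ as∈) = ∈-concatMap⁺ _ (lose a∈ (∈-map⁺ _ (listsOfLen-complete n as∈)))

-- Candidates are grouped by their length.
candidates-unique : ∀ n → Unique (candidates n)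
candidates-unique n = concatMap-unique (listsOfLen n) length (listsOfLen-length n) (listsOfLen-unique n) (entries-unique n)

parts-bounded : ∀ {S} x → Positive x → sum x ≤ S → All (_∈ entries S) x
parts-bounded [] _ _ = []
parts-bounded (a ∷ x) (1≤a , pos) le =
  entries-complete 1≤a (≤-trans (m≤m+n a (sum x)) le) ∷ parts-bounded x pos (≤-trans (m≤n+m (sum x) a) le)

length-≤-sum : ∀ x → Positive x → length x ≤ sum x
length-≤-sum [] _ = z≤n
length-≤-sum (a ∷ x) (1≤a , pos) = +-mono-≤ 1≤a (length-≤-sum x pos)

candidates-complete : ∀ n {x} → IsAscComp (suc n) x → x ∈ candidates (suc n)
candidates-complete n {[]} (_ , _ , ())
candidates-complete n {x@(_ ∷ _)} (pos , _ , s) =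
  ∈-concatMap⁺ (listsOfLen (suc n))
    (lose (entries-complete (s≤s z≤n) (subst (length x ≤_) s (length-≤-sum x pos)))
          (listsOfLen-complete (suc n) (parts-bounded x pos (≤-reflexive s))))

positive⇔ : ∀ x → Positive x ⇔ All (1 ≤_) x
positive⇔ x = mk⇔ (to x) (from x)
  where
  to : ∀ x → Positive x → All (1 ≤_) x
  to [] _ = []
  to (a ∷ x) (1≤a , pos) = 1≤a ∷ to x pos
  from : ∀ x → All (1 ≤_) x → Positive x
  from [] _ = tt
  from (a ∷ x) (1≤a ∷ pos) = 1≤a , from x pos

candidates-count : ∀ n {R Q : List ℕ → Set} (R? : Decidable R) (Q? : Decidable Q) →
                   (∀ {x} → R x ⇔ (IsAscComp (suc n) x × Q x)) →
                   length (filter R? (candidates (suc n))) ≡ count Q? (suc n) 1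
candidates-count n R? Q? R⇔ =
  length-≡ (Unique.filter⁺ R? (candidates-unique (suc n))) (Unique.filter⁺ Q? (enum-unique (suc (suc n)) (suc n) 1))
    (mk⇔ to from)
  where
  to : ∀ {x} → x ∈ filter R? (candidates (suc n)) → x ∈ filter Q? (partitions (suc n) 1)
  to {x} x∈ with Equivalence.to R⇔ (proj₂ (∈-filter⁻ R? {xs = candidates (suc n)} x∈))
  ... | (pos , asc , s) , qx =
    ∈-filter⁺ Q? (partitions-complete (s≤s z≤n) (asc , Equivalence.to (positive⇔ x) pos , s)) qx
  from : ∀ {x} → x ∈ filter Q? (partitions (suc n) 1) → x ∈ filter R? (candidates (suc n))
  from {x} x∈ with ∈-filter⁻ Q? x∈
  ... | x∈parts , qx with enum-sound (suc (suc n)) (suc n) 1 x∈parts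
  ...   | asc , parts , s =
    let comp = Equivalence.from (positive⇔ x) parts , asc , s
    in ∈-filter⁺ R? (candidates-complete n comp) (Equivalence.from R⇔ (comp , qx))

numNonterminal≡ntCount : ∀ n → numNonterminal (suc n) ≡ ntCount (suc n) 1
numNonterminal≡ntCount n =
  candidates-count n (λ x → isAscComp? (suc n) x ×-dec nonterminal? x) nonterminal? (mk⇔ id id)

p≡partCount : ∀ n → p n ≡ partCount n 1
p≡partCount zero = refl
p≡partCount (suc n) = candidates-count n (isAscComp? (suc n)) U? (mk⇔ (_, tt) proj₁)

-- n = 1 has no nonterminal composition; otherwise apply N(2+j,1) = P(j,1).
corollary4p7 : (n : ℕ) → numNonterminal (suc n) ≡ pMinus2 (suc n)
corollary4p7 zero = refl
corollary4p7 (suc j) = begin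
  numNonterminal (2 + j)  ≡⟨ numNonterminal≡ntCount (suc j) ⟩
  ntCount (2 + j) 1       ≡⟨ ntCount-shift j ≤-refl (m≤m+n 2 j) (m<m+n j (s≤s z≤n)) ⟩
  partCount j 1           ≡⟨ sym (p≡partCount j) ⟩
  p j                     ∎
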